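{- Let $n=2k+r$ with integers $k,r\ge 0$, and let $SYT_n(r)$ be the set of all standard Young tableaux with $n$ cells whose shape has exactly $r$ columns of odd length. Then: (1) The minimum of $\mathrm{maj}(T)$ over $T\in SYT_n(r)$ equals $k$, and it is attained by a tableau of shape $(n-k,k)$. (2) The maximum of $\mathrm{maj}(T)$ over $T\in SYT_n(r)$ equals $\binom{n}{2}-\binom{r}{2}$, and it is attained by a tableau of shape $(r,1^{2k})$ (i.e. one row of length $r$ followed by $2k$ rows of length $1$).
   Context: A Young diagram of shape $\lambda=(\lambda_0\ge\lambda_1\ge\cdots)$ has left-justified rows of lengths $\lambda_0,\lambda_1,\dots$ from top to bottom. A standard Young tableau of shape $\lambda\vdash n$ is a filling of the cells by $1,\dots,n$ increasing along rows and down columns. For a standard Young tableau $T$, $i\in\{1,\dots,n-1\}$ is a descent of $T$ if $i+1$ appears in a lower row of $T$ than $i$; $\mathrm{maj}(T)$ is the sum of the descents of $T$. The notation $1^{2k}$ means $2k$ parts equal to $1$; $\binom{r}{2}=0$ for $r\le 1$. -}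

module Defs where

open import Data.Nat using (ℕ; zero; suc; _+_; _∸_; _<_; _<ᵇ_; _≡ᵇ_; _%_; _≟_; _<?_)
open import Data.Bool using (if_then_else_)
open import Data.List using (List; []; _∷_; length; map; concat; filter; upTo; replicate)
open import Data.Bool.ListAction using (any)
open import Data.Nat.ListAction using (sum)
open import Data.Maybe using (Maybe; just; nothing)
open import Data.Product using (∃; _×_)
open import Data.List.Relation.Unary.All using (All)
open import Data.List.Relation.Binary.Permutation.Propositional using (_↭_)
open import Relation.Binary.PropositionalEquality using (_≡_)
open import Relation.Nullary using (¬_)

-- A tableau is given by its list of rows (top to bottom), each row a list
-- of entries from left to right.
Tableau : Set
Tableau = List (List ℕ)

shape : Tableau → List ℕ
shape = map length

lookupL : List ℕ → ℕ → Maybe ℕ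
lookupL []       _       = nothing
lookupL (x ∷ _)  zero    = just x
lookupL (_ ∷ xs) (suc j) = lookupL xs j

at : Tableau → ℕ → ℕ → Maybe ℕ
at []        _       j = nothing
at (row ∷ _) zero    j = lookupL row j
at (_ ∷ T)   (suc i) j = at T i j

-- T is a standard Young tableau with n cells:
--  * every row is nonempty,
--  * every cell below another cell has that cell above it (so row lengths
--    weakly decrease: the shape is a partition) and entries increase down columns,
--  * entries increase along rows,
--  * the entries are exactly 1, ..., n (each once).
record IsSYT (n : ℕ) (T : Tableau) : Set where
  field
    rowsNonempty : All (λ row → ¬ (row ≡ [])) T
    colIncr : ∀ i j y → at T (suc i) j ≡ just y → ∃ λ x → at T i j ≡ just x × x < y
    rowIncr : ∀ i j x y → at T i j ≡ just x → at T i (suc j) ≡ just y → x < y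
    entries : concat T ↭ map suc (upTo n)

rowOf : Tableau → ℕ → ℕ
rowOf []          x = 0
rowOf (row ∷ T)   x = if any (λ y → y ≡ᵇ x) row then 0 else suc (rowOf T x)

size : Tableau → ℕ
size T = length (concat T)

-- i is a descent iff i+1 lies in a strictly lower row than i
maj : Tableau → ℕ
maj T = sum (map (λ i → if rowOf T i <ᵇ rowOf T (suc i) then i else 0)
                 (map suc (upTo (size T ∸ 1))))

-- first part λ₀ of a shape (0 for the empty shape) = number of columns
firstPart : List ℕ → ℕ
firstPart []      = 0
firstPart (p ∷ _) = p

colLen : List ℕ → ℕ → ℕ
colLen λs j = length (filter (λ p → j <? p) λs)

oddCols : List ℕ → ℕ
oddCols λs = length (filter (λ j → colLen λs j % 2 ≟ 1) (upTo (firstPart λs)))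

-- remove zero parts (so that e.g. (n-k,k) with k = 0 means (n))
dropZeros : List ℕ → List ℕ
dropZeros = filter (λ p → 0 <? p)

-- Let R y be the row of the entry y and let a be the number of entries outside row 0, so that
-- n = a + λ₀. Lower bound: between consecutive descents d < d′ rows weakly decrease, so the entry
-- directly above an entry of (d, d′] outside row 0 lies in [1, d]; this map is injective, hence the
-- block contains at most d such entries and a ≤ maj T. The columns j with λ₁ ≤ j < λ₀ have length
-- one, so λ₀ ≤ r + λ₁ ≤ r + a, and 2k = n − r ≤ 2a ≤ 2 maj T. Upper bound: for a descent i the entry
-- i + 1 is outside row 0, so maj T ≤ Σ (y − 1) over entries y outside row 0, which is at most
-- C(n,2) − C(λ₀,2) ≤ C(n,2) − C(r,2) because r ≤ λ₀. The minimum is attained by the two-row tableau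
-- with rows 1, …, k, 2k + 1, …, 2k + r and k + 1, …, 2k (its only descent is k), the maximum by the
-- hook with first row 1, …, r (its descents are r, …, n − 1; for r = 0, the single column).

module Submission where

open import Defs
open import Data.Bool.Base using (Bool; true; false; if_then_else_; T)
open import Data.Bool.ListAction using (any)
open import Data.Empty using (⊥-elim)
open import Data.List.Base
  using (List; []; _∷_; _++_; map; concat; filter; length; replicate; applyUpTo; upTo)
open import Data.List.Properties hiding (sum-++)
open import Data.List.Membership.Propositional using (_∈_; _∉_)
open import Data.List.Membership.Propositional.Properties
open import Data.List.Relation.Binary.Permutation.Propositional
  using (_↭_; ↭-sym; ↭-reflexive; ↭-trans; ↭⇒↭ₛ)
open import Data.List.Relation.Binary.Permutation.Propositional.Properties
  using (∈-resp-↭; ↭-length; ++⁺ˡ; ++-comm)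
import Data.List.Relation.Binary.Permutation.Setoid.Properties as PermutationSetoid
open import Data.List.Relation.Binary.Subset.Propositional using (_⊆_)
open import Data.List.Relation.Unary.All as All using (All; []; _∷_)
open import Data.List.Relation.Unary.All.Properties using () renaming (replicate⁺ to All-replicate⁺)
open import Data.List.Relation.Unary.AllPairs using ([]; _∷_)
open import Data.List.Relation.Unary.Any using (here; there)
open import Data.List.Relation.Unary.Linked as Linked using (Linked; []; [-]; _∷_)
open import Data.List.Relation.Unary.Linked.Properties using (Linked⇒All)
open import Data.List.Relation.Unary.Unique.Propositional using (Unique)
import Data.List.Relation.Unary.Unique.Propositional.Properties as Unique
open import Data.Maybe.Base using (just; fromMaybe)
open import Data.Maybe.Properties using (just-injective)
open import Data.Nat.Base
open import Data.Nat.Combinatorics using (_C_; nCk+nC[k+1]≡[n+1]C[k+1]; nC1≡n)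
open import Data.Nat.DivMod using (_%_; m%n<n; [m+kn]%n≡m%n; m*n%n≡0)
open import Data.Nat.ListAction using (sum)
open import Data.Nat.ListAction.Properties using (sum-++)
open import Data.Nat.Properties
open import Algebra.Properties.CommutativeSemigroup +-commutativeSemigroup
  using (xy∙z≈xz∙y)
open import Data.Nat.Solver using (module +-*-Solver)
open import Data.Product using (∃; _×_; _,_; proj₁; proj₂)
open import Data.Sum using (inj₁; inj₂)
open import Data.Unit using (tt)
open import Function.Base using (_∘′_)
open import Level using (0ℓ)
open import Relation.Binary.PropositionalEquality
open import Relation.Nullary using (¬_; yes; no; does)
open import Relation.Unary using (Pred; Decidable)

Unique-∷ : ∀ {x : ℕ} {xs} → x ∉ xs → Unique xs → Unique (x ∷ xs)
Unique-∷ x∉xs u = All.tabulate (λ y∈xs x≡y → x∉xs (subst (_∈ _) (sym x≡y) y∈xs)) ∷ u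

Unique-tail : ∀ {x : ℕ} {xs} → Unique (x ∷ xs) → Unique xs
Unique-tail (_ ∷ u) = u

Unique-resp-↭ : ∀ {xs ys : List ℕ} → xs ↭ ys → Unique xs → Unique ys
Unique-resp-↭ p = PermutationSetoid.Unique-resp-↭ (setoid ℕ) (↭⇒↭ₛ p)

Unique-++⁻ˡ : ∀ (xs : List ℕ) {ys} → Unique (xs ++ ys) → Unique xs
Unique-++⁻ˡ []       u = []
Unique-++⁻ˡ (x ∷ xs) u =
  Unique-∷ (λ x∈xs → Unique.Unique[x∷xs]⇒x∉xs u (∈-++⁺ˡ x∈xs)) (Unique-++⁻ˡ xs (Unique-tail u))

Unique-++⁻ʳ : ∀ (xs : List ℕ) {ys} → Unique (xs ++ ys) → Unique ys
Unique-++⁻ʳ []       u = u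
Unique-++⁻ʳ (x ∷ xs) u = Unique-++⁻ʳ xs (Unique-tail u)

Unique-++⇒disjoint : ∀ (xs : List ℕ) {ys y} → Unique (xs ++ ys) → y ∈ xs → y ∉ ys
Unique-++⇒disjoint (x ∷ xs) u (here refl) y∈ys = Unique.Unique[x∷xs]⇒x∉xs u (∈-++⁺ʳ xs y∈ys)
Unique-++⇒disjoint (x ∷ xs) u (there y∈xs) = Unique-++⇒disjoint xs (Unique-tail u) y∈xs

Unique-map⁺ : ∀ (f : ℕ → ℕ) {xs} → (∀ {x y} → x ∈ xs → y ∈ xs → f x ≡ f y → x ≡ y) →
              Unique xs → Unique (map f xs)
Unique-map⁺ f {[]}     inj u = []
Unique-map⁺ f {x ∷ xs} inj u = Unique-∷ fx∉ (Unique-map⁺ f (λ p q → inj (there p) (there q)) (Unique-tail u))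
  where
  fx∉ : f x ∉ map f xs
  fx∉ fx∈ with ∈-map⁻ f fx∈
  ... | y , y∈xs , fx≡fy = Unique.Unique[x∷xs]⇒x∉xs u
                             (subst (_∈ xs) (sym (inj (here refl) (there y∈xs) fx≡fy)) y∈xs)

length-mono-⊆ : ∀ (xs : List ℕ) {ys} → Unique xs → xs ⊆ ys → length xs ≤ length ys
length-mono-⊆ []       u xs⊆ys = z≤n
length-mono-⊆ (x ∷ xs) u xs⊆ys with ∈-∃++ (xs⊆ys (here refl))
... | ys₁ , ys₂ , refl = begin
    suc (length xs)           ≤⟨ s≤s (length-mono-⊆ xs (Unique-tail u) xs⊆ys₁ys₂) ⟩
    suc (length (ys₁ ++ ys₂))  ≡⟨ length-++-sucʳ ys₁ x ys₂ ⟨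
    length (ys₁ ++ x ∷ ys₂)    ∎
  where
  open ≤-Reasoning
  delete : ∀ {y} zs → y ∈ zs ++ x ∷ ys₂ → y ≢ x → y ∈ zs ++ ys₂
  delete []       (here refl)  y≢x = ⊥-elim (y≢x refl)
  delete []       (there y∈)   y≢x = y∈
  delete (z ∷ zs) (here refl)  y≢x = here refl
  delete (z ∷ zs) (there y∈)   y≢x = there (delete zs y∈ y≢x)
  xs⊆ys₁ys₂ : xs ⊆ ys₁ ++ ys₂
  xs⊆ys₁ys₂ y∈xs = delete ys₁ (xs⊆ys (there y∈xs))
    (λ y≡x → Unique.Unique[x∷xs]⇒x∉xs u (subst (_∈ xs) y≡x y∈xs))

interval : ℕ → ℕ → List ℕ
interval a zero    = []
interval a (suc m) = a ∷ interval (suc a) m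

applyUpTo≡interval : ∀ (f : ℕ → ℕ) a m → (∀ i → f i ≡ a + i) → applyUpTo f m ≡ interval a m
applyUpTo≡interval f a zero    f≗a+ = refl
applyUpTo≡interval f a (suc m) f≗a+ = cong₂ _∷_ (trans (f≗a+ 0) (+-identityʳ a))
  (applyUpTo≡interval (f ∘′ suc) (suc a) m (λ i → trans (f≗a+ (suc i)) (+-suc a i)))

upTo≡interval : ∀ n → upTo n ≡ interval 0 n
upTo≡interval n = applyUpTo≡interval (λ i → i) 0 n (λ i → refl)

map-suc-upTo≡interval : ∀ n → map suc (upTo n) ≡ interval 1 n
map-suc-upTo≡interval n = trans (map-upTo suc n) (applyUpTo≡interval suc 1 n (λ i → refl))

∈-interval⁻ : ∀ {y} a m → y ∈ interval a m → a ≤ y × y < a + m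
∈-interval⁻ a (suc m) (here refl) = ≤-refl , m<m+n a z<s
∈-interval⁻ {y} a (suc m) (there y∈) with ∈-interval⁻ (suc a) m y∈
... | a<y , y<1+a+m = <⇒≤ a<y , subst (y <_) (sym (+-suc a m)) y<1+a+m

∈-interval⁺ : ∀ {y} a m → a ≤ y → y < a + m → y ∈ interval a m
∈-interval⁺ {y} a zero    a≤y y<a+0 = ⊥-elim (<⇒≱ y<a+0 (subst (_≤ y) (sym (+-identityʳ a)) a≤y))
∈-interval⁺ {y} a (suc m) a≤y y<a+m with a ≟ y
... | yes refl = here refl
... | no  a≢y  = there (∈-interval⁺ (suc a) m (≤∧≢⇒< a≤y a≢y) (subst (y <_) (+-suc a m) y<a+m))

interval-unique : ∀ a m → Unique (interval a m)
interval-unique a zero    = []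
interval-unique a (suc m) =
  Unique-∷ (λ a∈ → <-irrefl refl (proj₁ (∈-interval⁻ (suc a) m a∈))) (interval-unique (suc a) m)

interval≢[] : ∀ {a m} → 1 ≤ m → interval a m ≢ []
interval≢[] {m = suc _} _ ()

length-interval : ∀ a m → length (interval a m) ≡ m
length-interval a zero    = refl
length-interval a (suc m) = cong suc (length-interval (suc a) m)

interval-++ : ∀ a m p → interval a (m + p) ≡ interval a m ++ interval (a + m) p
interval-++ a zero    p = cong (λ b → interval b p) (sym (+-identityʳ a))
interval-++ a (suc m) p = cong (a ∷_) (trans (interval-++ (suc a) m p)
                                         (cong (λ b → interval (suc a) m ++ interval b p) (sym (+-suc a m))))

interval-snoc : ∀ a m → interval a (suc m) ≡ interval a m ++ (a + m) ∷ []
interval-snoc a m = trans (cong (interval a) (+-comm 1 m)) (interval-++ a m 1)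

sumTo : (ℕ → ℕ) → ℕ → ℕ
sumTo f zero    = 0
sumTo f (suc m) = sumTo f m + f (suc m)

sum-map-interval≡sumTo : ∀ (f : ℕ → ℕ) m → sum (map f (interval 1 m)) ≡ sumTo f m
sum-map-interval≡sumTo f zero    = refl
sum-map-interval≡sumTo f (suc m) = begin
  sum (map f (interval 1 (suc m)))             ≡⟨ cong (sum ∘′ map f) (interval-snoc 1 m) ⟩
  sum (map f (interval 1 m ++ suc m ∷ []))     ≡⟨ cong sum (map-++ f (interval 1 m) (suc m ∷ [])) ⟩
  sum (map f (interval 1 m) ++ f (suc m) ∷ []) ≡⟨ sum-++ (map f (interval 1 m)) (f (suc m) ∷ []) ⟩
  sum (map f (interval 1 m)) + (f (suc m) + 0) ≡⟨ cong₂ _+_ (sum-map-interval≡sumTo f m) (+-identityʳ _) ⟩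
  sumTo f m + f (suc m)                        ∎
  where open ≡-Reasoning

sumTo-cong : ∀ f g m → (∀ i → 1 ≤ i → i ≤ m → f i ≡ g i) → sumTo f m ≡ sumTo g m
sumTo-cong f g zero    f≗g = refl
sumTo-cong f g (suc m) f≗g =
  cong₂ _+_ (sumTo-cong f g m (λ i 1≤i i≤m → f≗g i 1≤i (m≤n⇒m≤1+n i≤m)))
            (f≗g (suc m) (s≤s z≤n) ≤-refl)

sumTo-zero : ∀ f m → (∀ i → 1 ≤ i → i ≤ m → f i ≡ 0) → sumTo f m ≡ 0
sumTo-zero f zero    f≗0 = refl
sumTo-zero f (suc m) f≗0 =
  cong₂ _+_ (sumTo-zero f m (λ i 1≤i i≤m → f≗0 i 1≤i (m≤n⇒m≤1+n i≤m)))
            (f≗0 (suc m) (s≤s z≤n) ≤-refl)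

sumTo-single : ∀ f k m → 1 ≤ k → k ≤ m → (∀ i → 1 ≤ i → i ≤ m → i ≢ k → f i ≡ 0) →
               sumTo f m ≡ f k
sumTo-single f k zero    1≤k k≤0 _ = ⊥-elim (<⇒≱ 1≤k k≤0)
sumTo-single f k (suc m) 1≤k k≤1+m f≗0 with m≤n⇒m<n∨m≡n k≤1+m
... | inj₂ refl = begin
    sumTo f m + f k   ≡⟨ cong (_+ f k) (sumTo-zero f m
                           (λ i 1≤i i≤m → f≗0 i 1≤i (m≤n⇒m≤1+n i≤m) (<⇒≢ (s≤s i≤m)))) ⟩
    0 + f k           ∎
  where open ≡-Reasoning
... | inj₁ (s≤s k≤m) = begin
    sumTo f m + f (suc m)   ≡⟨ cong₂ _+_
                                 (sumTo-single f k m 1≤k k≤m (λ i 1≤i i≤m → f≗0 i 1≤i (m≤n⇒m≤1+n i≤m)))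
                                 (f≗0 (suc m) (s≤s z≤n) ≤-refl (>⇒≢ (s≤s k≤m))) ⟩
    f k + 0                 ≡⟨ +-identityʳ (f k) ⟩
    f k                     ∎
  where open ≡-Reasoning

suc-C-2 : ∀ m → suc m C 2 ≡ m C 2 + m
suc-C-2 m = begin
  suc m C 2       ≡⟨ nCk+nC[k+1]≡[n+1]C[k+1] m 1 ⟨
  m C 1 + m C 2   ≡⟨ cong (_+ m C 2) (nC1≡n m) ⟩
  m + m C 2       ≡⟨ +-comm m (m C 2) ⟩
  m C 2 + m       ∎
  where open ≡-Reasoning

C-2-mono-≤ : ∀ {a b} → a ≤ b → a C 2 ≤ b C 2
C-2-mono-≤ {a} {zero}  z≤n = ≤-refl
C-2-mono-≤ {a} {suc b} a≤1+b with m≤n⇒m<n∨m≡n a≤1+b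
... | inj₂ refl        = ≤-refl
... | inj₁ (s≤s a≤b)   =
  ≤-trans (C-2-mono-≤ a≤b) (≤-trans (m≤m+n (b C 2) b) (≤-reflexive (sym (suc-C-2 b))))

isDescent : (ℕ → ℕ) → ℕ → Bool
isDescent R i = R i <ᵇ R (suc i)

majTerm : (ℕ → ℕ) → ℕ → ℕ
majTerm R i = if isDescent R i then i else 0

isDescent-true : ∀ R i → isDescent R i ≡ true → R i < R (suc i)
isDescent-true R i eq = <ᵇ⇒< (R i) (R (suc i)) (subst T (sym eq) tt)

isDescent-false : ∀ R i → isDescent R i ≡ false → R (suc i) ≤ R i
isDescent-false R i eq = ≮⇒≥ (λ lt → subst T eq (<⇒<ᵇ lt))

majTerm-descent : ∀ R i → R i < R (suc i) → majTerm R i ≡ i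
majTerm-descent R i Ri<Ri+1 with isDescent R i | <⇒<ᵇ Ri<Ri+1
... | true  | _  = refl
... | false | ()

majTerm-nonDescent : ∀ R i → R (suc i) ≤ R i → majTerm R i ≡ 0
majTerm-nonDescent R i Ri+1≤Ri with isDescent R i in eq
... | true  = ⊥-elim (<⇒≱ (isDescent-true R i eq) Ri+1≤Ri)
... | false = refl

maj≡sumTo : ∀ T → maj T ≡ sumTo (majTerm (rowOf T)) (size T ∸ 1)
maj≡sumTo T = trans (cong (sum ∘′ map (majTerm (rowOf T))) (map-suc-upTo≡interval (size T ∸ 1)))
                    (sum-map-interval≡sumTo (majTerm (rowOf T)) (size T ∸ 1))

module Counting {P : Pred ℕ 0ℓ} (P? : Decidable P) where

  count : ℕ → ℕ → ℕ
  count a e = length (filter P? (interval (suc a) (e ∸ a)))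

  indicator : ℕ → ℕ
  indicator x = if does (P? x) then 1 else 0

  indicator-yes : ∀ {x} → P x → indicator x ≡ 1
  indicator-yes {x} px with P? x
  ... | yes _   = refl
  ... | no ¬px  = ⊥-elim (¬px px)

  indicator-no : ∀ {x} → ¬ P x → indicator x ≡ 0
  indicator-no {x} ¬px with P? x
  ... | yes px = ⊥-elim (¬px px)
  ... | no _   = refl

  indicator≤1 : ∀ x → indicator x ≤ 1
  indicator≤1 x with does (P? x)
  ... | true  = ≤-refl
  ... | false = z≤n

  count-self : ∀ a → count a a ≡ 0
  count-self a = cong (length ∘′ filter P? ∘′ interval (suc a)) (n∸n≡0 a)

  count0≤ : ∀ e → count 0 e ≤ e
  count0≤ e = ≤-trans (length-filter P? (interval 1 e)) (≤-reflexive (length-interval 1 e))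

  count-suc : ∀ a e → a ≤ e → count a (suc e) ≡ count a e + indicator (suc e)
  count-suc a e a≤e = begin
      length (filter P? (interval (suc a) (suc e ∸ a)))
    ≡⟨ cong (length ∘′ filter P?) (trans (cong (interval (suc a)) (+-∸-assoc 1 a≤e))
                                         (interval-snoc (suc a) (e ∸ a))) ⟩
      length (filter P? (block ++ (suc a + (e ∸ a)) ∷ []))
    ≡⟨ cong length (filter-++ P? block _) ⟩
      length (filter P? block ++ filter P? ((suc a + (e ∸ a)) ∷ []))
    ≡⟨ length-++ (filter P? block) ⟩
      count a e + length (filter P? ((suc a + (e ∸ a)) ∷ []))
    ≡⟨ cong (λ z → count a e + length (filter P? (suc z ∷ []))) (m+[n∸m]≡n a≤e) ⟩
      count a e + length (filter P? (suc e ∷ []))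
    ≡⟨ cong (count a e +_) (length-filter-singleton (suc e)) ⟩
      count a e + indicator (suc e)
    ∎
    where
    open ≡-Reasoning
    block : List ℕ
    block = interval (suc a) (e ∸ a)
    length-filter-singleton : ∀ x → length (filter P? (x ∷ [])) ≡ indicator x
    length-filter-singleton x with does (P? x)
    ... | true  = refl
    ... | false = refl

-- R y is the row of the entry y and above y the entry just above it.
module OffTopRowsBound
  (n : ℕ) (R : ℕ → ℕ) (above : ℕ → ℕ)
  (above-smaller : ∀ y → 1 ≤ y → y ≤ n → 1 ≤ R y →
                   1 ≤ above y × above y < y × R (above y) < R y)
  (above-injective : ∀ y y′ → 1 ≤ y → y ≤ n → 1 ≤ R y → 1 ≤ y′ → y′ ≤ n → 1 ≤ R y′ →
                     above y ≡ above y′ → y ≡ y′)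
  where

  open Counting (λ y → 1 ≤? R y)

  lastDescent : ℕ → ℕ
  lastDescent zero    = 0
  lastDescent (suc x) = if isDescent R (suc x) then suc x else lastDescent x

  lastDescent≤ : ∀ x → lastDescent x ≤ x
  lastDescent≤ zero = z≤n
  lastDescent≤ (suc x) with isDescent R (suc x)
  ... | true  = ≤-refl
  ... | false = m≤n⇒m≤1+n (lastDescent≤ x)

  NoDescentIn : ℕ → ℕ → Set
  NoDescentIn d x = ∀ i → d < i → i ≤ x → isDescent R i ≡ false

  noDescentAfterLast : ∀ x → NoDescentIn (lastDescent x) x
  noDescentAfterLast zero    i d<i i≤0 = ⊥-elim (<⇒≱ d<i i≤0)
  noDescentAfterLast (suc x) i d<i i≤1+x with isDescent R (suc x) in eq
  ... | true = ⊥-elim (<⇒≱ d<i i≤1+x)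
  ... | false with m≤n⇒m<n∨m≡n i≤1+x
  ...   | inj₁ (s≤s i≤x) = noDescentAfterLast x i d<i i≤x
  ...   | inj₂ refl      = eq

  rows-antitone : ∀ {d x} → NoDescentIn d x → ∀ {a b} → d < a → a ≤ b → b ≤ suc x → R b ≤ R a
  rows-antitone noDesc {a} {b} d<a a≤b b≤1+x with m≤n⇒m<n∨m≡n a≤b
  ... | inj₂ refl = ≤-refl
  rows-antitone noDesc {a} {suc b} d<a _ b<1+x | inj₁ (s≤s a≤b) =
    ≤-trans (isDescent-false R b (noDesc b (≤-trans d<a a≤b) (≤-pred b<1+x)))
            (rows-antitone noDesc d<a a≤b (m≤n⇒m≤1+n (≤-pred b<1+x)))

  block-bound : ∀ d x → d ≤ x → suc x ≤ n → NoDescentIn d x → count d (suc x) ≤ d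
  block-bound d x d≤x 1+x≤n noDesc = begin
      length offTop               ≡⟨ length-map above offTop ⟨
      length (map above offTop)   ≤⟨ length-mono-⊆ (map above offTop) unique above∈[1,d] ⟩
      length (interval 1 d)       ≡⟨ length-interval 1 d ⟩
      d                           ∎
    where
    open ≤-Reasoning
    offTop : List ℕ
    offTop = filter (λ y → 1 ≤? R y) (interval (suc d) (suc x ∸ d))
    ∈offTop⁻ : ∀ {y} → y ∈ offTop → suc d ≤ y × y ≤ suc x × 1 ≤ R y
    ∈offTop⁻ {y} y∈ with ∈-filter⁻ (λ y → 1 ≤? R y) {xs = interval (suc d) (suc x ∸ d)} y∈
    ... | y∈block , 1≤Ry with ∈-interval⁻ (suc d) (suc x ∸ d) y∈block
    ... | d<y , y<end = d<y , ≤-pred (subst (y <_) (cong suc (m+[n∸m]≡n (m≤n⇒m≤1+n d≤x))) y<end) , 1≤Ry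
    valid : ∀ {y} → y ∈ offTop → 1 ≤ y × y ≤ n × 1 ≤ R y
    valid y∈ with ∈offTop⁻ y∈
    ... | d<y , y≤1+x , 1≤Ry = ≤-trans (s≤s z≤n) d<y , ≤-trans y≤1+x 1+x≤n , 1≤Ry
    unique : Unique (map above offTop)
    unique = Unique-map⁺ above
      (λ y∈ y′∈ → let (a , b , c) = valid y∈ ; (a′ , b′ , c′) = valid y′∈
                  in above-injective _ _ a b c a′ b′ c′)
      (Unique.filter⁺ (λ y → 1 ≤? R y) (interval-unique (suc d) (suc x ∸ d)))
    above∈[1,d] : map above offTop ⊆ interval 1 d
    above∈[1,d] z∈ with ∈-map⁻ above z∈
    ... | y , y∈ , refl with ∈offTop⁻ y∈ | valid y∈
    ... | _ , y≤1+x , _ | (a , b , c) with above-smaller _ a b c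
    ... | 1≤above , above<y , Rabove<Ry with above y ≤? d
    ...   | yes above≤d = ∈-interval⁺ 1 d 1≤above (s≤s above≤d)
    ...   | no  above≰d = ⊥-elim (<⇒≱ Rabove<Ry
                            (rows-antitone noDesc (≰⇒> above≰d) (<⇒≤ above<y) y≤1+x))

  -- Adding lastDescent x on the left keeps the invariant free of truncated subtraction.
  invariant : ∀ x → suc x ≤ n →
              count 0 (suc x) + lastDescent x ≤ sumTo (majTerm R) x + count (lastDescent x) (suc x)
  invariant zero _ = ≤-reflexive (+-comm (count 0 1) 0)
  invariant (suc x) 2+x≤n
    with invariant x (≤-trans (n≤1+n _) 2+x≤n)
       | block-bound (lastDescent x) x (lastDescent≤ x) (≤-trans (n≤1+n _) 2+x≤n) (noDescentAfterLast x)
  ... | ih | bound with isDescent R (suc x) in eq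
  ... | true = begin
      count 0 (suc (suc x)) + suc x             ≡⟨ cong (_+ suc x) (count-suc 0 (suc x) z≤n) ⟩
      count 0 (suc x) + indicator (2 + x) + suc x ≡⟨ cong (λ z → count 0 (suc x) + z + suc x) 2+x-offTop ⟩
      count 0 (suc x) + 1 + suc x               ≤⟨ +-monoˡ-≤ (suc x) (+-monoˡ-≤ 1 count≤S) ⟩
      S + 1 + suc x                             ≡⟨ xy∙z≈xz∙y S 1 (suc x) ⟩
      S + suc x + 1                             ≡⟨ cong (S + suc x +_) count-last ⟨
      S + suc x + count (suc x) (suc (suc x))   ∎
    where
    open ≤-Reasoning
    S : ℕ
    S = sumTo (majTerm R) x
    2+x-offTop : indicator (2 + x) ≡ 1
    2+x-offTop = indicator-yes (≤-trans (s≤s z≤n) (isDescent-true R (suc x) eq))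
    count-last : count (suc x) (suc (suc x)) ≡ 1
    count-last = trans (count-suc (suc x) (suc x) ≤-refl)
                       (trans (cong (_+ indicator (2 + x)) (count-self (suc x))) 2+x-offTop)
    count≤S : count 0 (suc x) ≤ S
    count≤S = +-cancelʳ-≤ (lastDescent x) _ _ (≤-trans ih (+-monoʳ-≤ S bound))
  ... | false = begin
      count 0 (suc (suc x)) + d             ≡⟨ cong (_+ d) (count-suc 0 (suc x) z≤n) ⟩
      count 0 (suc x) + b + d               ≡⟨ xy∙z≈xz∙y (count 0 (suc x)) b d ⟩
      count 0 (suc x) + d + b               ≤⟨ +-monoˡ-≤ b ih ⟩
      S + count d (suc x) + b               ≡⟨ +-assoc S _ b ⟩
      S + (count d (suc x) + b)             ≡⟨ cong (S +_) (count-suc d (suc x) (m≤n⇒m≤1+n (lastDescent≤ x))) ⟨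
      S + count d (suc (suc x))             ≡⟨ cong (_+ count d (suc (suc x))) (+-identityʳ S) ⟨
      S + 0 + count d (suc (suc x))         ∎
    where
    open ≤-Reasoning
    S d b : ℕ
    S = sumTo (majTerm R) x
    d = lastDescent x
    b = indicator (2 + x)

  offTop≤sumTo-majTerm : count 0 n ≤ sumTo (majTerm R) (n ∸ 1)
  offTop≤sumTo-majTerm = go n refl
    where
    go : ∀ m → m ≡ n → count 0 m ≤ sumTo (majTerm R) (m ∸ 1)
    go zero    _    = z≤n
    go (suc x) 1+x≡n = +-cancelʳ-≤ (lastDescent x) _ _
      (≤-trans (invariant x (≤-reflexive 1+x≡n))
               (+-monoʳ-≤ _ (block-bound (lastDescent x) x (lastDescent≤ x) (≤-reflexive 1+x≡n)
                                         (noDescentAfterLast x))))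

module TopRowBound (R : ℕ → ℕ) where

  open Counting (λ y → R y ≟ 0)

  sumTo-majTerm+C-2≤C-2 : ∀ x → sumTo (majTerm R) x + count 0 (suc x) C 2 ≤ suc x C 2
  sumTo-majTerm+C-2≤C-2 zero = C-2-mono-≤ (count0≤ 1)
  sumTo-majTerm+C-2≤C-2 (suc x) with sumTo-majTerm+C-2≤C-2 x
  ... | ih with isDescent R (suc x) in eq
  ... | true = begin
      S + suc x + c′ C 2     ≡⟨ cong (λ z → S + suc x + z C 2) c′≡c ⟩
      S + suc x + c C 2      ≡⟨ xy∙z≈xz∙y S (suc x) (c C 2) ⟩
      S + c C 2 + suc x      ≤⟨ +-monoˡ-≤ (suc x) ih ⟩
      suc x C 2 + suc x      ≡⟨ suc-C-2 (suc x) ⟨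
      suc (suc x) C 2        ∎
    where
    open ≤-Reasoning
    S c c′ : ℕ
    S = sumTo (majTerm R) x
    c = count 0 (suc x)
    c′ = count 0 (suc (suc x))
    c′≡c : c′ ≡ c
    c′≡c = trans (count-suc 0 (suc x) z≤n)
      (trans (cong (c +_) (indicator-no (λ R≡0 → <⇒≢ (≤-trans (s≤s z≤n) (isDescent-true R (suc x) eq))
                                                           (sym R≡0))))
             (+-identityʳ c))
  ... | false = begin
      S + 0 + c′ C 2         ≡⟨ cong (_+ c′ C 2) (+-identityʳ S) ⟩
      S + c′ C 2             ≤⟨ +-monoʳ-≤ S (C-2-mono-≤ c′≤1+c) ⟩
      S + suc c C 2          ≡⟨ cong (S +_) (suc-C-2 c) ⟩
      S + (c C 2 + c)        ≡⟨ +-assoc S _ _ ⟨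
      S + c C 2 + c          ≤⟨ +-mono-≤ ih (count0≤ (suc x)) ⟩
      suc x C 2 + suc x      ≡⟨ suc-C-2 (suc x) ⟨
      suc (suc x) C 2        ∎
    where
    open ≤-Reasoning
    S c c′ : ℕ
    S = sumTo (majTerm R) x
    c = count 0 (suc x)
    c′ = count 0 (suc (suc x))
    c′≤1+c : c′ ≤ suc c
    c′≤1+c = begin
      c′                           ≡⟨ count-suc 0 (suc x) z≤n ⟩
      c + indicator (suc (suc x))  ≤⟨ +-monoʳ-≤ c (indicator≤1 _) ⟩
      c + 1                        ≡⟨ +-comm c 1 ⟩
      suc c                        ∎

∈⇒any≡ᵇ : ∀ {y} xs → y ∈ xs → any (_≡ᵇ y) xs ≡ true
∈⇒any≡ᵇ {y} (x ∷ xs) (here refl) with y ≡ᵇ y in eq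
... | true  = refl
... | false = ⊥-elim (subst T eq (≡⇒≡ᵇ y y refl))
∈⇒any≡ᵇ {y} (x ∷ xs) (there y∈) with x ≡ᵇ y
... | true  = refl
... | false = ∈⇒any≡ᵇ xs y∈

any≡ᵇ⇒∈ : ∀ {y} xs → any (_≡ᵇ y) xs ≡ true → y ∈ xs
any≡ᵇ⇒∈ {y} (x ∷ xs) eq with x ≡ᵇ y in x≡ᵇy
... | true  = here (sym (≡ᵇ⇒≡ x y (subst T (sym x≡ᵇy) tt)))
... | false = there (any≡ᵇ⇒∈ xs eq)

∉⇒any≡ᵇ : ∀ {y} xs → y ∉ xs → any (_≡ᵇ y) xs ≡ false
∉⇒any≡ᵇ {y} xs y∉ with any (_≡ᵇ y) xs in eq
... | true  = ⊥-elim (y∉ (any≡ᵇ⇒∈ xs eq))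
... | false = refl

rowOf-here : ∀ {y} row T → y ∈ row → rowOf (row ∷ T) y ≡ 0
rowOf-here {y} row T y∈ = cong (λ b → if b then 0 else suc (rowOf T y)) (∈⇒any≡ᵇ row y∈)

rowOf-there : ∀ {y} row T → y ∉ row → rowOf (row ∷ T) y ≡ suc (rowOf T y)
rowOf-there {y} row T y∉ = cong (λ b → if b then 0 else suc (rowOf T y)) (∉⇒any≡ᵇ row y∉)

lookupL⇒∈ : ∀ xs j {y} → lookupL xs j ≡ just y → y ∈ xs
lookupL⇒∈ (x ∷ xs) zero    refl = here refl
lookupL⇒∈ (x ∷ xs) (suc j) eq   = there (lookupL⇒∈ xs j eq)

∈⇒lookupL : ∀ {y} xs → y ∈ xs → ∃ λ j → lookupL xs j ≡ just y
∈⇒lookupL (x ∷ xs) (here refl) = 0 , refl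
∈⇒lookupL (x ∷ xs) (there y∈) with ∈⇒lookupL xs y∈
... | j , eq = suc j , eq

lookupL⇒<length : ∀ xs j {y} → lookupL xs j ≡ just y → j < length xs
lookupL⇒<length (x ∷ xs) zero    eq = s≤s z≤n
lookupL⇒<length (x ∷ xs) (suc j) eq = s≤s (lookupL⇒<length xs j eq)

<length⇒lookupL : ∀ xs j → j < length xs → ∃ λ y → lookupL xs j ≡ just y
<length⇒lookupL (x ∷ xs) zero    _         = x , refl
<length⇒lookupL (x ∷ xs) (suc j) (s≤s j<) = <length⇒lookupL xs j j<

lookupL-injective : ∀ xs j j′ {y} → Unique xs →
                    lookupL xs j ≡ just y → lookupL xs j′ ≡ just y → j ≡ j′
lookupL-injective (x ∷ xs) zero    zero     u eq  eq′  = refl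
lookupL-injective (x ∷ xs) zero    (suc j′) u refl eq′ =
  ⊥-elim (Unique.Unique[x∷xs]⇒x∉xs u (lookupL⇒∈ xs j′ eq′))
lookupL-injective (x ∷ xs) (suc j) zero     u eq  refl =
  ⊥-elim (Unique.Unique[x∷xs]⇒x∉xs u (lookupL⇒∈ xs j eq))
lookupL-injective (x ∷ xs) (suc j) (suc j′) u eq  eq′  =
  cong suc (lookupL-injective xs j j′ (Unique-tail u) eq eq′)

lookupL-++ˡ : ∀ xs {ys} j → j < length xs → lookupL (xs ++ ys) j ≡ lookupL xs j
lookupL-++ˡ (x ∷ xs) zero    _         = refl
lookupL-++ˡ (x ∷ xs) (suc j) (s≤s j<) = lookupL-++ˡ xs j j<

lookupL-interval⁻ : ∀ a m j {x} → lookupL (interval a m) j ≡ just x → x ≡ a + j × j < m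
lookupL-interval⁻ a (suc m) zero    refl = sym (+-identityʳ a) , s≤s z≤n
lookupL-interval⁻ a (suc m) (suc j) eq with lookupL-interval⁻ (suc a) m j eq
... | refl , j<m = sym (+-suc a j) , s≤s j<m

lookupL-interval⁺ : ∀ a m j → j < m → lookupL (interval a m) j ≡ just (a + j)
lookupL-interval⁺ a (suc m) zero    _         = cong just (sym (+-identityʳ a))
lookupL-interval⁺ a (suc m) (suc j) (s≤s j<m) =
  trans (lookupL-interval⁺ (suc a) m j j<m) (cong just (sym (+-suc a j)))

rowAt : Tableau → ℕ → List ℕ
rowAt []      _       = []
rowAt (r ∷ T) zero    = r
rowAt (r ∷ T) (suc i) = rowAt T i

at≡lookupL-rowAt : ∀ T i j → at T i j ≡ lookupL (rowAt T i) j
at≡lookupL-rowAt []      i       j = refl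
at≡lookupL-rowAt (r ∷ T) zero    j = refl
at≡lookupL-rowAt (r ∷ T) (suc i) j = at≡lookupL-rowAt T i j

rowAt⊆concat : ∀ T i → rowAt T i ⊆ concat T
rowAt⊆concat (r ∷ T) zero    y∈ = ∈-++⁺ˡ y∈
rowAt⊆concat (r ∷ T) (suc i) y∈ = ∈-++⁺ʳ r (rowAt⊆concat T i y∈)

Unique-rowAt : ∀ T i → Unique (concat T) → Unique (rowAt T i)
Unique-rowAt []      i       u = []
Unique-rowAt (r ∷ T) zero    u = Unique-++⁻ˡ r u
Unique-rowAt (r ∷ T) (suc i) u = Unique-rowAt T i (Unique-++⁻ʳ r u)

at⇒∈concat : ∀ T i j {y} → at T i j ≡ just y → y ∈ concat T
at⇒∈concat T i j eq = rowAt⊆concat T i (lookupL⇒∈ (rowAt T i) j (trans (sym (at≡lookupL-rowAt T i j)) eq))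

rowOf-at : ∀ T i j {y} → Unique (concat T) → at T i j ≡ just y → rowOf T y ≡ i
rowOf-at (r ∷ T) zero    j u eq = rowOf-here r T (lookupL⇒∈ r j eq)
rowOf-at (r ∷ T) (suc i) j u eq =
  trans (rowOf-there r T (λ y∈r → Unique-++⇒disjoint r u y∈r (at⇒∈concat T i j eq)))
        (cong suc (rowOf-at T i j (Unique-++⁻ʳ r u) eq))

at-injective : ∀ T i j i′ j′ {y} → Unique (concat T) →
               at T i j ≡ just y → at T i′ j′ ≡ just y → i ≡ i′ × j ≡ j′
at-injective T i j i′ j′ u eq eq′ with trans (sym (rowOf-at T i j u eq)) (rowOf-at T i′ j′ u eq′)
... | refl = refl , lookupL-injective (rowAt T i) j j′ (Unique-rowAt T i u)
                      (trans (sym (at≡lookupL-rowAt T i j)) eq) (trans (sym (at≡lookupL-rowAt T i j′)) eq′)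

indexOf : List ℕ → ℕ → ℕ
indexOf []       y = 0
indexOf (x ∷ xs) y = if x ≡ᵇ y then 0 else suc (indexOf xs y)

lookupL-indexOf : ∀ xs y → any (_≡ᵇ y) xs ≡ true → lookupL xs (indexOf xs y) ≡ just y
lookupL-indexOf (x ∷ xs) y eq with x ≡ᵇ y in x≡ᵇy
... | true  = cong just (≡ᵇ⇒≡ x y (subst T (sym x≡ᵇy) tt))
... | false = lookupL-indexOf xs y eq

colOf : Tableau → ℕ → ℕ
colOf []        y = 0
colOf (row ∷ T) y = if any (_≡ᵇ y) row then indexOf row y else colOf T y

at-rowOf-colOf : ∀ T {y} → y ∈ concat T → at T (rowOf T y) (colOf T y) ≡ just y
at-rowOf-colOf (row ∷ T) {y} y∈ with any (_≡ᵇ y) row in eq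
... | true  = lookupL-indexOf row y eq
... | false with ∈-++⁻ row y∈
...   | inj₁ y∈row with () ← trans (sym (∈⇒any≡ᵇ row y∈row)) eq
...   | inj₂ y∈T   = at-rowOf-colOf T y∈T

-- Junk value 0 for entries of row 0.
above : Tableau → ℕ → ℕ
above T y = fromMaybe 0 (at T (pred (rowOf T y)) (colOf T y))

part : List ℕ → ℕ → ℕ
part []       i       = 0
part (p ∷ λs) zero    = p
part (p ∷ λs) (suc i) = part λs i

firstPart≡part₀ : ∀ λs → firstPart λs ≡ part λs 0
firstPart≡part₀ []      = refl
firstPart≡part₀ (_ ∷ _) = refl

oddCols≤firstPart : ∀ λs → oddCols λs ≤ firstPart λs
oddCols≤firstPart λs =
  ≤-trans (length-filter (λ j → colLen λs j % 2 ≟ 1) (upTo (firstPart λs)))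
          (≤-reflexive (length-upTo (firstPart λs)))

Linked-≥⇒All≤firstPart : ∀ {λs} → Linked _≥_ λs → All (_≤ firstPart λs) λs
Linked-≥⇒All≤firstPart []        = []
Linked-≥⇒All≤firstPart [-]       = ≤-refl ∷ []
Linked-≥⇒All≤firstPart (q≥ ∷ qs) = ≤-refl ∷ Linked⇒All (λ x≥y y≥z → ≤-trans y≥z x≥y) q≥ qs

secondPart≤firstPart : ∀ {p λs} → Linked _≥_ (p ∷ λs) → firstPart λs ≤ p
secondPart≤firstPart [-]       = z≤n
secondPart≤firstPart (p≥q ∷ _) = p≥q

part₀≤oddCols+part₁ : ∀ λs → Linked _≥_ λs → part λs 0 ≤ oddCols λs + part λs 1
part₀≤oddCols+part₁ []       _ = z≤n
part₀≤oddCols+part₁ (p ∷ λs) antitone = begin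
    p                                  ≡⟨ m∸n+n≡m q≤p ⟨
    p ∸ q + q                          ≡⟨ cong (_+ q) (length-interval q (p ∸ q)) ⟨
    length (interval q (p ∸ q)) + q    ≤⟨ +-monoˡ-≤ q (length-mono-⊆ _ (interval-unique q _) ⊆oddColumns) ⟩
    oddCols (p ∷ λs) + q               ≡⟨ cong (oddCols (p ∷ λs) +_) (firstPart≡part₀ λs) ⟩
    oddCols (p ∷ λs) + part λs 0       ∎
  where
  open ≤-Reasoning
  q : ℕ
  q = firstPart λs
  q≤p : q ≤ p
  q≤p = secondPart≤firstPart antitone
  λs≤q : All (_≤ q) λs
  λs≤q = Linked-≥⇒All≤firstPart (Linked.tail antitone)
  colLen≡1 : ∀ {j} → q ≤ j → j < p → colLen (p ∷ λs) j ≡ 1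
  colLen≡1 {j} q≤j j<p = cong length
    (trans (filter-accept (j <?_) {xs = λs} j<p)
           (cong (p ∷_) (filter-none (j <?_)
                          (All.map (λ pᵢ≤q j<pᵢ → <⇒≱ j<pᵢ (≤-trans pᵢ≤q q≤j)) λs≤q))))
  ⊆oddColumns : interval q (p ∸ q) ⊆ filter (λ j → colLen (p ∷ λs) j % 2 ≟ 1) (upTo p)
  ⊆oddColumns {j} j∈ with ∈-interval⁻ q (p ∸ q) j∈
  ... | q≤j , j<end = ∈-filter⁺ (λ j → colLen (p ∷ λs) j % 2 ≟ 1)
      (subst (j ∈_) (sym (upTo≡interval p)) (∈-interval⁺ 0 p z≤n j<p))
      (cong (_% 2) (colLen≡1 q≤j j<p))
    where
    j<p : j < p
    j<p = subst (j <_) (m+[n∸m]≡n q≤p) j<end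

ColumnClosed : Tableau → Set
ColumnClosed T = ∀ i j y → at T (suc i) j ≡ just y → ∃ λ x → at T i j ≡ just x

shape-antitone : ∀ T → ColumnClosed T → Linked _≥_ (shape T)
shape-antitone []             closed = []
shape-antitone (r ∷ [])       closed = [-]
shape-antitone (r ∷ r′ ∷ T) closed = r′≤r ∷ shape-antitone (r′ ∷ T) (λ i → closed (suc i))
  where
  r′≤r : length r′ ≤ length r
  r′≤r with length r′ in eq
  ... | zero  = z≤n
  ... | suc m with <length⇒lookupL r′ m (subst (m <_) (sym eq) ≤-refl)
  ...   | y , r′[m]≡y with closed 0 m y r′[m]≡y
  ...     | x , r[m]≡x = lookupL⇒<length r m r[m]≡x

part-shape : ∀ T i → part (shape T) i ≡ length (rowAt T i)
part-shape []      i       = refl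
part-shape (r ∷ T) zero    = refl
part-shape (r ∷ T) (suc i) = part-shape T i

module StandardTableau {n : ℕ} {T : Tableau} (syt : IsSYT n T) where

  open IsSYT syt

  size≡n : size T ≡ n
  size≡n = trans (↭-length entries) (trans (length-map suc (upTo n)) (length-upTo n))

  entries-unique : Unique (concat T)
  entries-unique = Unique-resp-↭ (↭-sym entries)
    (subst Unique (sym (map-suc-upTo≡interval n)) (interval-unique 1 n))

  ∈entries⁻ : ∀ {y} → y ∈ concat T → 1 ≤ y × y ≤ n
  ∈entries⁻ y∈ with ∈-interval⁻ 1 n (subst (_ ∈_) (map-suc-upTo≡interval n) (∈-resp-↭ entries y∈))
  ... | 1≤y , y<1+n = 1≤y , ≤-pred y<1+n

  ∈entries⁺ : ∀ {y} → 1 ≤ y → y ≤ n → y ∈ concat T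
  ∈entries⁺ 1≤y y≤n = ∈-resp-↭ (↭-sym entries)
    (subst (_ ∈_) (sym (map-suc-upTo≡interval n)) (∈-interval⁺ 1 n 1≤y (s≤s y≤n)))

  columnClosed : ColumnClosed T
  columnClosed i j y eq with colIncr i j y eq
  ... | x , eq′ , _ = x , eq′

  R : ℕ → ℕ
  R = rowOf T

  at-above : ∀ y → 1 ≤ y → y ≤ n → 1 ≤ R y →
             at T (pred (R y)) (colOf T y) ≡ just (above T y) × above T y < y
  at-above y 1≤y y≤n 1≤Ry with R y | at-rowOf-colOf T (∈entries⁺ 1≤y y≤n)
  ... | suc i | eq with colIncr i (colOf T y) y eq
  ...   | x , eq′ , x<y rewrite eq′ = refl , x<y

  above-smaller : ∀ y → 1 ≤ y → y ≤ n → 1 ≤ R y → 1 ≤ above T y × above T y < y × R (above T y) < R y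
  above-smaller y 1≤y y≤n 1≤Ry with at-above y 1≤y y≤n 1≤Ry
  ... | eq , above<y =
    proj₁ (∈entries⁻ (at⇒∈concat T _ _ eq)) , above<y ,
    subst (_< R y) (sym (rowOf-at T _ _ entries-unique eq)) (≤-reflexive (suc-pred (R y) {{>-nonZero 1≤Ry}}))

  above-injective : ∀ y y′ → 1 ≤ y → y ≤ n → 1 ≤ R y → 1 ≤ y′ → y′ ≤ n → 1 ≤ R y′ →
                    above T y ≡ above T y′ → y ≡ y′
  above-injective y y′ 1≤y y≤n 1≤Ry 1≤y′ y′≤n 1≤Ry′ eq
    with at-above y 1≤y y≤n 1≤Ry | at-above y′ 1≤y′ y′≤n 1≤Ry′
  ... | at≡ , _ | at≡′ , _ with at-injective T _ _ _ _ entries-unique at≡ (trans at≡′ (cong just (sym eq)))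
  ... | pred-R≡ , col≡ = just-injective (begin
      just y                          ≡⟨ at-rowOf-colOf T (∈entries⁺ 1≤y y≤n) ⟨
      at T (R y) (colOf T y)          ≡⟨ cong₂ (at T) R≡ col≡ ⟩
      at T (R y′) (colOf T y′)        ≡⟨ at-rowOf-colOf T (∈entries⁺ 1≤y′ y′≤n) ⟩
      just y′                         ∎)
    where
    open ≡-Reasoning
    R≡ : R y ≡ R y′
    R≡ = trans (sym (suc-pred (R y) {{>-nonZero 1≤Ry}}))
               (trans (cong suc pred-R≡) (suc-pred (R y′) {{>-nonZero 1≤Ry′}}))

  module OffTop = Counting (λ y → 1 ≤? R y)
  module Top    = Counting (λ y → R y ≟ 0)

  offTop top : ℕ
  offTop = OffTop.count 0 n
  top    = Top.count 0 n

  offTop+top≡n : offTop + top ≡ n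
  offTop+top≡n = trans (complement (interval 1 n)) (length-interval 1 n)
    where
    complement : ∀ xs → length (filter (λ y → 1 ≤? R y) xs) + length (filter (λ y → R y ≟ 0) xs) ≡ length xs
    complement []       = refl
    complement (x ∷ xs) with 1 ≤? R x | R x ≟ 0
    ... | yes 1≤Rx | yes Rx≡0 = ⊥-elim (<⇒≢ 1≤Rx (sym Rx≡0))
    ... | yes 1≤Rx | no Rx≢0
      rewrite filter-accept (λ y → 1 ≤? R y) {xs = xs} 1≤Rx | filter-reject (λ y → R y ≟ 0) {xs = xs} Rx≢0
      = cong suc (complement xs)
    ... | no 1≰Rx  | yes Rx≡0
      rewrite filter-reject (λ y → 1 ≤? R y) {xs = xs} 1≰Rx | filter-accept (λ y → R y ≟ 0) {xs = xs} Rx≡0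
      = trans (+-suc _ _) (cong suc (complement xs))
    ... | no 1≰Rx  | no Rx≢0  = ⊥-elim (1≰Rx (n≢0⇒n>0 Rx≢0))

  top≡part₀ : top ≡ part (shape T) 0
  top≡part₀ = trans (≤-antisym top≤ ≤top) (sym (part-shape T 0))
    where
    top≤ : top ≤ length (rowAt T 0)
    top≤ = length-mono-⊆ _ (Unique.filter⁺ (λ y → R y ≟ 0) (interval-unique 1 n)) topEntries⊆topRow
      where
      topEntries⊆topRow : filter (λ y → R y ≟ 0) (interval 1 n) ⊆ rowAt T 0
      topEntries⊆topRow {y} y∈ with ∈-filter⁻ (λ y → R y ≟ 0) {xs = interval 1 n} y∈
      ... | y∈[1,n] , Ry≡0 with ∈-interval⁻ 1 n y∈[1,n]
      ... | 1≤y , y<1+n = lookupL⇒∈ (rowAt T 0) (colOf T y)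
            (trans (sym (at≡lookupL-rowAt T 0 (colOf T y)))
                   (subst (λ i → at T i (colOf T y) ≡ just y) Ry≡0
                          (at-rowOf-colOf T (∈entries⁺ 1≤y (≤-pred y<1+n)))))
    ≤top : length (rowAt T 0) ≤ top
    ≤top = length-mono-⊆ _ (Unique-rowAt T 0 entries-unique) topRow⊆topEntries
      where
      topRow⊆topEntries : rowAt T 0 ⊆ filter (λ y → R y ≟ 0) (interval 1 n)
      topRow⊆topEntries {y} y∈ with ∈⇒lookupL (rowAt T 0) y∈ | ∈entries⁻ (rowAt⊆concat T 0 y∈)
      ... | j , eq | 1≤y , y≤n = ∈-filter⁺ (λ y → R y ≟ 0) (∈-interval⁺ 1 n 1≤y (s≤s y≤n))
                                   (rowOf-at T 0 j entries-unique (trans (at≡lookupL-rowAt T 0 j) eq))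

  part₁≤offTop : part (shape T) 1 ≤ offTop
  part₁≤offTop = subst (_≤ offTop) (sym (part-shape T 1))
    (length-mono-⊆ _ (Unique-rowAt T 1 entries-unique) ⊆offTop)
    where
    ⊆offTop : rowAt T 1 ⊆ filter (λ y → 1 ≤? R y) (interval 1 n)
    ⊆offTop {y} y∈ with ∈⇒lookupL (rowAt T 1) y∈ | ∈entries⁻ (rowAt⊆concat T 1 y∈)
    ... | j , eq | 1≤y , y≤n = ∈-filter⁺ (λ y → 1 ≤? R y) (∈-interval⁺ 1 n 1≤y (s≤s y≤n))
        (≤-reflexive (sym (rowOf-at T 1 j entries-unique (trans (at≡lookupL-rowAt T 1 j) eq))))

  maj≡sumTo-majTerm : maj T ≡ sumTo (majTerm R) (n ∸ 1)
  maj≡sumTo-majTerm = trans (maj≡sumTo T) (cong (λ m → sumTo (majTerm R) (m ∸ 1)) size≡n)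

  offTop≤maj : offTop ≤ maj T
  offTop≤maj = subst (offTop ≤_) (sym maj≡sumTo-majTerm)
    (OffTopRowsBound.offTop≤sumTo-majTerm n R (above T) above-smaller above-injective)

  maj+top-C-2≤n-C-2 : maj T + top C 2 ≤ n C 2
  maj+top-C-2≤n-C-2 = subst (λ m → m + top C 2 ≤ n C 2) (sym maj≡sumTo-majTerm) (bound n)
    where
    bound : ∀ m → sumTo (majTerm R) (m ∸ 1) + Top.count 0 m C 2 ≤ m C 2
    bound zero    = z≤n
    bound (suc x) = TopRowBound.sumTo-majTerm+C-2≤C-2 R x

  n≤oddCols+2*maj : n ≤ oddCols (shape T) + 2 * maj T
  n≤oddCols+2*maj = begin
      n                               ≡⟨ offTop+top≡n ⟨
      offTop + top                    ≡⟨ cong (offTop +_) top≡part₀ ⟩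
      offTop + part (shape T) 0       ≤⟨ +-monoʳ-≤ offTop (part₀≤oddCols+part₁ (shape T) antitone) ⟩
      offTop + (o + part (shape T) 1) ≤⟨ +-monoʳ-≤ offTop (+-monoʳ-≤ o part₁≤offTop) ⟩
      offTop + (o + offTop)           ≡⟨ +-*-Solver.solve 2 (λ a b → a :+ (b :+ a) := b :+ con 2 :* a)
                                                          refl offTop o ⟩
      o + 2 * offTop                  ≤⟨ +-monoʳ-≤ o (*-monoʳ-≤ 2 offTop≤maj) ⟩
      o + 2 * maj T                   ∎
    where
    open ≤-Reasoning
    open +-*-Solver using (_:+_; _:*_; _:=_; con)
    o : ℕ
    o = oddCols (shape T)
    antitone : Linked _≥_ (shape T)
    antitone = shape-antitone T columnClosed

  maj≤n-C-2∸r-C-2 : ∀ {r} → oddCols (shape T) ≡ r → maj T ≤ n C 2 ∸ r C 2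
  maj≤n-C-2∸r-C-2 refl = ≤-trans (m+n≤o⇒m≤o∸n (maj T) maj+top-C-2≤n-C-2)
    (∸-monoʳ-≤ (n C 2) (C-2-mono-≤ (≤-trans (oddCols≤firstPart (shape T))
                                           (≤-reflexive (trans (firstPart≡part₀ (shape T)) (sym top≡part₀))))))

Linked-<-interval : ∀ a m → Linked _<_ (interval a m)
Linked-<-interval a zero          = []
Linked-<-interval a (suc zero)    = [-]
Linked-<-interval a (suc (suc m)) = ≤-refl ∷ Linked-<-interval (suc a) (suc m)

Linked-<-++⁺ : ∀ {xs ys} → Linked _<_ xs → Linked _<_ ys → (∀ {x y} → x ∈ xs → y ∈ ys → x < y) →
               Linked _<_ (xs ++ ys)
Linked-<-++⁺ []                  ys<        xs<ys = ys<
Linked-<-++⁺ {ys = []}    [-]    _          xs<ys = [-]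
Linked-<-++⁺ {ys = _ ∷ _} [-]    ys<        xs<ys = xs<ys (here refl) (here refl) ∷ ys<
Linked-<-++⁺ (x<y ∷ xs<)         ys<        xs<ys = x<y ∷ Linked-<-++⁺ xs< ys< (xs<ys ∘′ there)

Linked-<-lookupL : ∀ xs j {x y} → Linked _<_ xs → lookupL xs j ≡ just x → lookupL xs (suc j) ≡ just y → x < y
Linked-<-lookupL (_ ∷ _ ∷ _) zero    (x<y ∷ _)   refl refl = x<y
Linked-<-lookupL (_ ∷ _ ∷ _) (suc j) (_ ∷ <xs)  eq   eq′  = Linked-<-lookupL _ j <xs eq eq′
Linked-<-lookupL (_ ∷ [])    (suc j) _          ()   _

column : ℕ → ℕ → Tableau
column a m = map (_∷ []) (interval a m)

at-column⁻ : ∀ a m i j {y} → at (column a m) i j ≡ just y → j ≡ 0 × y ≡ a + i × i < m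
at-column⁻ a (suc m) zero    zero refl = refl , sym (+-identityʳ a) , s≤s z≤n
at-column⁻ a (suc m) (suc i) j    eq with at-column⁻ (suc a) m i j eq
... | refl , refl , i<m = refl , sym (+-suc a i) , s≤s i<m

at-column⁺ : ∀ a m i → i < m → at (column a m) i 0 ≡ just (a + i)
at-column⁺ a (suc m) zero    _         = cong just (sym (+-identityʳ a))
at-column⁺ a (suc m) (suc i) (s≤s i<m) = trans (at-column⁺ (suc a) m i i<m) (cong just (sym (+-suc a i)))

rowOf-column : ∀ a m y → a ≤ y → y < a + m → rowOf (column a m) y ≡ y ∸ a
rowOf-column a m y a≤y y<a+m with ∈⇒lookupL (interval a m) (∈-interval⁺ a m a≤y y<a+m)
... | i , eq with lookupL-interval⁻ a m i eq
... | refl , i<m = trans (rowOf-at (column a m) i 0 unique (at-column⁺ a m i i<m)) (sym (m+n∸m≡n a i))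
  where
  unique : Unique (concat (column a m))
  unique = subst Unique (sym (concat-map-[ interval a m ])) (interval-unique a m)

shape-column : ∀ a m → shape (column a m) ≡ replicate m 1
shape-column a zero    = refl
shape-column a (suc m) = cong (1 ∷_) (shape-column (suc a) m)

hook : ℕ → ℕ → Tableau
hook t m = interval 1 t ∷ column (suc t) m

concat-hook : ∀ t m → concat (hook t m) ≡ interval 1 (t + m)
concat-hook t m = trans (cong (interval 1 t ++_) (concat-map-[ interval (suc t) m ])) (sym (interval-++ 1 t m))

hook-isSYT : ∀ t m → 1 ≤ t → IsSYT (t + m) (hook t m)
hook-isSYT (suc t′) m _ = record
  { rowsNonempty = (λ ()) ∷ All.tabulate columnRow≢[]
  ; colIncr      = colIncr
  ; rowIncr      = rowIncr
  ; entries      = ↭-reflexive (trans (concat-hook t m) (sym (map-suc-upTo≡interval (t + m))))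
  }
  where
  t : ℕ
  t = suc t′
  columnRow≢[] : ∀ {row} → row ∈ column (suc t) m → row ≢ []
  columnRow≢[] row∈ row≡[] with ∈-map⁻ (_∷ []) row∈
  ... | _ , _ , refl with () ← row≡[]
  colIncr : ∀ i j y → at (hook t m) (suc i) j ≡ just y → ∃ λ x → at (hook t m) i j ≡ just x × x < y
  colIncr zero    j y eq with at-column⁻ (suc t) m 0 j eq
  ... | refl , refl , _   = 1 , refl , s≤s (s≤s z≤n)
  colIncr (suc i) j y eq with at-column⁻ (suc t) m (suc i) j eq
  ... | refl , refl , i<m = suc t + i , at-column⁺ (suc t) m i (<⇒≤ i<m) , +-monoʳ-< (suc t) (n<1+n i)
  rowIncr : ∀ i j x y → at (hook t m) i j ≡ just x → at (hook t m) i (suc j) ≡ just y → x < y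
  rowIncr zero    j x y eq eq′ = Linked-<-lookupL (interval 1 t) j (Linked-<-interval 1 t) eq eq′
  rowIncr (suc i) j x y eq eq′ with at-column⁻ (suc t) m i (suc j) eq′
  ... | () , _

shape-hook : ∀ t m → shape (hook t m) ≡ t ∷ replicate m 1
shape-hook t m = cong₂ _∷_ (length-interval 1 t) (shape-column (suc t) m)

size-hook : ∀ t m → size (hook t m) ≡ t + m
size-hook t m = trans (cong length (concat-hook t m)) (length-interval 1 (t + m))

rowOf-hook : ∀ t m y → 1 ≤ y → y ≤ t + m → rowOf (hook t m) y ≡ y ∸ t
rowOf-hook t m y 1≤y y≤t+m with y ≤? t
... | yes y≤t = trans (rowOf-here (interval 1 t) (column (suc t) m) (∈-interval⁺ 1 t 1≤y (s≤s y≤t)))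
                      (sym (m≤n⇒m∸n≡0 y≤t))
... | no  y≰t = begin
    rowOf (hook t m) y                   ≡⟨ rowOf-there (interval 1 t) (column (suc t) m)
                                              (λ y∈ → y≰t (≤-pred (proj₂ (∈-interval⁻ 1 t y∈)))) ⟩
    suc (rowOf (column (suc t) m) y)     ≡⟨ cong suc (rowOf-column (suc t) m y (≰⇒> y≰t) (s≤s y≤t+m)) ⟩
    suc (y ∸ suc t)                      ≡⟨ +-∸-assoc 1 (≰⇒> y≰t) ⟨
    y ∸ t                                ∎
  where open ≡-Reasoning

majTerm-cong : ∀ R R′ i → R i ≡ R′ i → R (suc i) ≡ R′ (suc i) → majTerm R i ≡ majTerm R′ i
majTerm-cong R R′ i eq eq′ = cong (λ b → if b then i else 0) (cong₂ _<ᵇ_ eq eq′)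

-- _∸ suc t′ is the row function of the hook with first row 1, …, t′ + 1.
sumTo-majTerm-∸+C-2 : ∀ t′ m → sumTo (majTerm (_∸ suc t′)) (t′ + m) + suc t′ C 2 ≡ (suc t′ + m) C 2
sumTo-majTerm-∸+C-2 t′ zero = begin
    sumTo (majTerm (_∸ suc t′)) (t′ + 0) + suc t′ C 2  ≡⟨ cong (_+ suc t′ C 2) (sumTo-zero _ (t′ + 0) noDescent) ⟩
    suc t′ C 2                                        ≡⟨ cong (λ x → suc x C 2) (+-identityʳ t′) ⟨
    suc (t′ + 0) C 2                                  ∎
  where
  open ≡-Reasoning
  noDescent : ∀ i → 1 ≤ i → i ≤ t′ + 0 → majTerm (_∸ suc t′) i ≡ 0
  noDescent i _ i≤t′+0 = majTerm-nonDescent (_∸ suc t′) i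
    (≤-trans (≤-reflexive (m≤n⇒m∸n≡0 (≤-trans i≤t′+0 (≤-reflexive (+-identityʳ t′))))) z≤n)
sumTo-majTerm-∸+C-2 t′ (suc m) = begin
    sumTo f (t′ + suc m) + t C 2                   ≡⟨ cong (λ x → sumTo f x + t C 2) (+-suc t′ m) ⟩
    sumTo f (t′ + m) + f (suc (t′ + m)) + t C 2    ≡⟨ cong (λ x → sumTo f (t′ + m) + x + t C 2) descent ⟩
    sumTo f (t′ + m) + suc (t′ + m) + t C 2        ≡⟨ xy∙z≈xz∙y (sumTo f (t′ + m)) _ (t C 2) ⟩
    sumTo f (t′ + m) + t C 2 + suc (t′ + m)        ≡⟨ cong (_+ suc (t′ + m)) (sumTo-majTerm-∸+C-2 t′ m) ⟩
    (t + m) C 2 + (t + m)                          ≡⟨ suc-C-2 (t + m) ⟨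
    suc (t + m) C 2                                ≡⟨ cong (_C 2) (+-suc t m) ⟨
    (t + suc m) C 2                                ∎
  where
  open ≡-Reasoning
  t : ℕ
  t = suc t′
  f : ℕ → ℕ
  f = majTerm (_∸ t)
  descent : f (suc (t′ + m)) ≡ suc (t′ + m)
  descent = majTerm-descent (_∸ t) (suc (t′ + m))
    (subst₂ _<_ (sym (m+n∸m≡n t′ m))
                (trans (sym (m+n∸m≡n t′ (suc m))) (cong (_∸ t′) (+-suc t′ m)))
                ≤-refl)

maj-hook : ∀ t m → 1 ≤ t → maj (hook t m) ≡ (t + m) C 2 ∸ t C 2
maj-hook (suc t′) m _ = begin
    maj (hook t m)                                   ≡⟨ maj≡sumTo (hook t m) ⟩
    sumTo (majTerm R) (size (hook t m) ∸ 1)          ≡⟨ cong (λ s → sumTo (majTerm R) (s ∸ 1)) (size-hook t m) ⟩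
    sumTo (majTerm R) (t′ + m)                       ≡⟨ sumTo-cong _ _ (t′ + m) R≗∸t ⟩
    sumTo (majTerm (_∸ t)) (t′ + m)                  ≡⟨ m+n∸n≡m _ (t C 2) ⟨
    sumTo (majTerm (_∸ t)) (t′ + m) + t C 2 ∸ t C 2  ≡⟨ cong (_∸ t C 2) (sumTo-majTerm-∸+C-2 t′ m) ⟩
    (t + m) C 2 ∸ t C 2                              ∎
  where
  open ≡-Reasoning
  t : ℕ
  t = suc t′
  R : ℕ → ℕ
  R = rowOf (hook t m)
  R≗∸t : ∀ i → 1 ≤ i → i ≤ t′ + m → majTerm R i ≡ majTerm (_∸ t) i
  R≗∸t i 1≤i i≤t′+m = majTerm-cong R (_∸ t) i (rowOf-hook t m i 1≤i (m≤n⇒m≤1+n i≤t′+m))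
                                               (rowOf-hook t m (suc i) (s≤s z≤n) (s≤s i≤t′+m))

oddCols-hook : ∀ t′ m → oddCols (suc t′ ∷ replicate m 1) ≡ t′ + suc m % 2
oddCols-hook t′ m = begin
    length (filter odd? (0 ∷ applyUpTo suc t′))          ≡⟨ cong length (filter-∷ 0) ⟩
    length (filter odd? (0 ∷ []) ++ filter odd? armCols)  ≡⟨ length-++ (filter odd? (0 ∷ [])) ⟩
    length (filter odd? (0 ∷ [])) + length (filter odd? armCols)
        ≡⟨ cong₂ _+_ corner (cong length (filter-all odd? (All.tabulate arm-odd))) ⟩
    suc m % 2 + length armCols                            ≡⟨ cong (suc m % 2 +_) (length-applyUpTo suc t′) ⟩
    suc m % 2 + t′                                        ≡⟨ +-comm (suc m % 2) t′ ⟩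
    t′ + suc m % 2                                        ∎
  where
  open ≡-Reasoning
  λs : List ℕ
  λs = suc t′ ∷ replicate m 1
  odd? : Decidable (λ j → colLen λs j % 2 ≡ 1)
  odd? j = colLen λs j % 2 ≟ 1
  armCols : List ℕ
  armCols = applyUpTo suc t′
  filter-∷ : ∀ x {xs} → filter odd? (x ∷ xs) ≡ filter odd? (x ∷ []) ++ filter odd? xs
  filter-∷ x = filter-++ odd? (x ∷ []) _
  colLen₀ : colLen λs 0 ≡ suc m
  colLen₀ = cong suc (trans (cong length (filter-all (0 <?_) (All-replicate⁺ m (s≤s z≤n)))) (length-replicate m))
  corner : length (filter odd? (0 ∷ [])) ≡ suc m % 2
  corner with odd? 0
  ... | yes odd = trans (cong length (filter-accept odd? {x = 0} {xs = []} odd)) (trans (sym odd) (cong (_% 2) colLen₀))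
  ... | no ¬odd = trans (cong length (filter-reject odd? {x = 0} {xs = []} ¬odd))
                        (sym (trans (cong (_% 2) (sym colLen₀)) (bit≢1⇒≡0 (m%n<n (colLen λs 0) 2) ¬odd)))
    where
    bit≢1⇒≡0 : ∀ {c} → c < 2 → c ≢ 1 → c ≡ 0
    bit≢1⇒≡0 {zero}  _ _   = refl
    bit≢1⇒≡0 {suc zero} _ c≢1 = ⊥-elim (c≢1 refl)
    bit≢1⇒≡0 {suc (suc _)} (s≤s (s≤s ())) _
  arm-odd : ∀ {j} → j ∈ armCols → colLen λs j % 2 ≡ 1
  arm-odd {j} j∈ with ∈-interval⁻ 1 t′ (subst (j ∈_) (applyUpTo≡interval suc 1 t′ (λ _ → refl)) j∈)
  ... | 1≤j , j<1+t′ with j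
  ... | suc j′ = cong (λ l → length l % 2)
    (trans (filter-accept (suc j′ <?_) {xs = replicate m 1} j<1+t′)
           (cong (suc t′ ∷_) (filter-none (suc j′ <?_) (All-replicate⁺ m (λ { (s≤s ()) })))))

twoRow : ℕ → ℕ → Tableau
twoRow k r = (interval 1 k ++ interval (suc (k + k)) r) ∷ interval (suc k) k ∷ []

module _ (k r : ℕ) where

  private
    row₀ row₁ : List ℕ
    row₀ = interval 1 k ++ interval (suc (k + k)) r
    row₁ = interval (suc k) k

  twoRow-entries : concat (twoRow k r) ↭ map suc (upTo (k + k + r))
  twoRow-entries = ↭-trans (↭-reflexive reassociate)
    (↭-trans (++⁺ˡ (interval 1 k) (++-comm (interval (suc (k + k)) r) row₁)) (↭-reflexive intervals))
    where
    reassociate : concat (twoRow k r) ≡ interval 1 k ++ (interval (suc (k + k)) r ++ row₁)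
    reassociate = trans (cong (row₀ ++_) (++-identityʳ row₁)) (++-assoc (interval 1 k) _ row₁)
    intervals : interval 1 k ++ (row₁ ++ interval (suc (k + k)) r) ≡ map suc (upTo (k + k + r))
    intervals = begin
      interval 1 k ++ (row₁ ++ interval (suc (k + k)) r)  ≡⟨ ++-assoc (interval 1 k) row₁ _ ⟨
      (interval 1 k ++ row₁) ++ interval (suc (k + k)) r  ≡⟨ cong (_++ interval (suc (k + k)) r) (interval-++ 1 k k) ⟨
      interval 1 (k + k) ++ interval (suc (k + k)) r      ≡⟨ interval-++ 1 (k + k) r ⟨
      interval 1 (k + k + r)                              ≡⟨ map-suc-upTo≡interval (k + k + r) ⟨
      map suc (upTo (k + k + r))                          ∎
      where open ≡-Reasoning

  twoRow-isSYT : 1 ≤ k → IsSYT (k + k + r) (twoRow k r)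
  twoRow-isSYT 1≤k = record
    { rowsNonempty = row₀≢[] ∷ row₁≢[] ∷ []
    ; colIncr      = colIncr
    ; rowIncr      = rowIncr
    ; entries      = twoRow-entries
    }
    where
    row₁≢[] : row₁ ≢ []
    row₁≢[] = interval≢[] 1≤k
    row₀≢[] : row₀ ≢ []
    row₀≢[] = interval≢[] 1≤k ∘′ ++-conicalˡ (interval 1 k) _
    colIncr : ∀ i j y → at (twoRow k r) (suc i) j ≡ just y → ∃ λ x → at (twoRow k r) i j ≡ just x × x < y
    colIncr zero j y eq with lookupL-interval⁻ (suc k) k j eq
    ... | refl , j<k = suc j , trans (lookupL-++ˡ (interval 1 k) j (subst (j <_) (sym (length-interval 1 k)) j<k))
                                     (lookupL-interval⁺ 1 k j j<k)
                             , s≤s (+-monoˡ-≤ j 1≤k)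
    rowIncr : ∀ i j x y → at (twoRow k r) i j ≡ just x → at (twoRow k r) i (suc j) ≡ just y → x < y
    rowIncr zero          j x y eq eq′ = Linked-<-lookupL row₀ j linked₀ eq eq′
      where
      linked₀ : Linked _<_ row₀
      linked₀ = Linked-<-++⁺ (Linked-<-interval 1 k) (Linked-<-interval _ r)
        (λ x∈ y∈ → <-≤-trans (proj₂ (∈-interval⁻ 1 k x∈))
                             (≤-trans (s≤s (m≤m+n k k)) (proj₁ (∈-interval⁻ _ r y∈))))
    rowIncr (suc zero)    j x y eq eq′ = Linked-<-lookupL row₁ j (Linked-<-interval (suc k) k) eq eq′

  shape-twoRow : shape (twoRow k r) ≡ k + r ∷ k ∷ []
  shape-twoRow = cong₂ _∷_ (trans (length-++ (interval 1 k)) (cong₂ _+_ (length-interval 1 k) (length-interval _ r)))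
                           (cong (_∷ []) (length-interval (suc k) k))

  -- Columns j < k have length 2, the others length 1.
  oddCols-twoRow : oddCols (k + r ∷ k ∷ []) ≡ r
  oddCols-twoRow = begin
      length (filter odd? (upTo (k + r)))
    ≡⟨ cong (length ∘′ filter odd?) (trans (upTo≡interval (k + r)) (interval-++ 0 k r)) ⟩
      length (filter odd? (interval 0 k ++ interval k r))
    ≡⟨ cong length (filter-++ odd? (interval 0 k) (interval k r)) ⟩
      length (filter odd? (interval 0 k) ++ filter odd? (interval k r))
    ≡⟨ cong₂ (λ xs ys → length (xs ++ ys)) (filter-none odd? (All.tabulate short-even))
                                           (filter-all odd? (All.tabulate long-odd)) ⟩
      length (interval k r)
    ≡⟨ length-interval k r ⟩
      r
    ∎
    where
    open ≡-Reasoning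
    λs : List ℕ
    λs = k + r ∷ k ∷ []
    odd? : Decidable (λ j → colLen λs j % 2 ≡ 1)
    odd? j = colLen λs j % 2 ≟ 1
    short-even : ∀ {j} → j ∈ interval 0 k → colLen λs j % 2 ≢ 1
    short-even {j} j∈ odd with ∈-interval⁻ 0 k j∈
    ... | _ , j<k = 0≢1+n (trans (sym (cong (_% 2) length≡2)) odd)
      where
      length≡2 : colLen λs j ≡ 2
      length≡2 = cong length (trans (filter-accept (j <?_) {xs = k ∷ []} (<-≤-trans j<k (m≤m+n k r)))
                                    (cong (k + r ∷_) (filter-accept (j <?_) {xs = []} j<k)))
    long-odd : ∀ {j} → j ∈ interval k r → colLen λs j % 2 ≡ 1
    long-odd {j} j∈ with ∈-interval⁻ k r j∈
    ... | k≤j , j<k+r = cong (λ xs → length xs % 2)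
      (trans (filter-accept (j <?_) {xs = k ∷ []} j<k+r)
             (cong (k + r ∷_) (filter-reject (j <?_) {xs = []} (≤⇒≯ k≤j))))

  private
    R : ℕ → ℕ
    R = rowOf (twoRow k r)

    R-low : ∀ {y} → 1 ≤ y → y ≤ k → R y ≡ 0
    R-low 1≤y y≤k = rowOf-here row₀ (row₁ ∷ []) (∈-++⁺ˡ (∈-interval⁺ 1 k 1≤y (s≤s y≤k)))

    R-high : ∀ {y} → k + k < y → y ≤ k + k + r → R y ≡ 0
    R-high 2k<y y≤n = rowOf-here row₀ (row₁ ∷ [])
      (∈-++⁺ʳ (interval 1 k) (∈-interval⁺ (suc (k + k)) r 2k<y (s≤s y≤n)))

    R-mid : ∀ {y} → k < y → y ≤ k + k → R y ≡ 1
    R-mid {y} k<y y≤2k = trans (rowOf-there row₀ (row₁ ∷ []) y∉row₀)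
                               (cong suc (rowOf-here row₁ [] (∈-interval⁺ (suc k) k k<y (s≤s y≤2k))))
      where
      y∉row₀ : y ∉ row₀
      y∉row₀ y∈ with ∈-++⁻ (interval 1 k) y∈
      ... | inj₁ y∈low  = <⇒≱ k<y (≤-pred (proj₂ (∈-interval⁻ 1 k y∈low)))
      ... | inj₂ y∈high = <⇒≱ (proj₁ (∈-interval⁻ _ r y∈high)) y≤2k

  maj-twoRow : 1 ≤ k → maj (twoRow k r) ≡ k
  maj-twoRow 1≤k = begin
      maj (twoRow k r)                            ≡⟨ maj≡sumTo (twoRow k r) ⟩
      sumTo (majTerm R) (size (twoRow k r) ∸ 1)   ≡⟨ cong (λ s → sumTo (majTerm R) (s ∸ 1)) size≡ ⟩
      sumTo (majTerm R) (n ∸ 1)                   ≡⟨ sumTo-single (majTerm R) k (n ∸ 1) 1≤k k≤n∸1 other ⟩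
      majTerm R k                                 ≡⟨ majTerm-descent R k k-isDescent ⟩
      k                                           ∎
    where
    open ≡-Reasoning
    n : ℕ
    n = k + k + r
    size≡ : size (twoRow k r) ≡ n
    size≡ = StandardTableau.size≡n (twoRow-isSYT 1≤k)
    k-isDescent : R k < R (suc k)
    k-isDescent = subst₂ _<_ (sym (R-low 1≤k ≤-refl)) (sym (R-mid ≤-refl 1+k≤k+k)) ≤-refl
      where
      1+k≤k+k : suc k ≤ k + k
      1+k≤k+k = subst (_≤ k + k) (+-comm k 1) (+-monoʳ-≤ k 1≤k)
    k≤n∸1 : k ≤ n ∸ 1
    k≤n∸1 = ≤-trans (m≤p+m∸1 k k 1≤k) (∸-monoˡ-≤ 1 (m≤m+n (k + k) r))
      where
      m≤p+m∸1 : ∀ m p → 1 ≤ p → m ≤ p + m ∸ 1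
      m≤p+m∸1 m (suc p) _ = m≤n+m m p
    other : ∀ i → 1 ≤ i → i ≤ n ∸ 1 → i ≢ k → majTerm R i ≡ 0
    other i 1≤i i≤n∸1 i≢k = majTerm-nonDescent R i R[i+1]≤R[i]
      where
      1+i≤n : suc i ≤ n
      1+i≤n = ≤-trans (s≤s i≤n∸1)
                      (≤-reflexive (m+[n∸m]≡n (≤-trans 1≤i (≤-trans i≤n∸1 (m∸n≤m n 1)))))
      R[i+1]≤R[i] : R (suc i) ≤ R i
      R[i+1]≤R[i] with suc i ≤? k | k + k <? suc i
      ... | yes 1+i≤k | _          = ≤-trans (≤-reflexive (R-low (s≤s z≤n) 1+i≤k)) z≤n
      ... | no _      | yes 2k<1+i = ≤-trans (≤-reflexive (R-high 2k<1+i 1+i≤n)) z≤n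
      ... | no 1+i≰k  | no 2k≮1+i  =
        ≤-reflexive (trans (R-mid k<1+i 1+i≤2k) (sym (R-mid k<i (≤-trans (n≤1+n i) 1+i≤2k))))
        where
        1+i≤2k : suc i ≤ k + k
        1+i≤2k = ≮⇒≥ 2k≮1+i
        k<1+i : k < suc i
        k<1+i = ≰⇒> 1+i≰k
        k<i : k < i
        k<i = ≤∧≢⇒< (≤-pred k<1+i) (i≢k ∘′ sym)

k≤maj : ∀ {k r T} → IsSYT (2 * k + r) T → oddCols (shape T) ≡ r → k ≤ maj T
k≤maj {k} {r} {T} syt refl = *-cancelˡ-≤ 2 (+-cancelˡ-≤ r (2 * k) (2 * maj T)
  (≤-trans (≤-reflexive (+-comm r (2 * k))) (StandardTableau.n≤oddCols+2*maj syt)))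

[]-isSYT : IsSYT 0 []
[]-isSYT = record
  { rowsNonempty = []
  ; colIncr      = λ _ _ _ ()
  ; rowIncr      = λ _ _ _ _ ()
  ; entries      = ↭-reflexive refl
  }

dropZeros-replicate : ∀ m → dropZeros (replicate m 1) ≡ replicate m 1
dropZeros-replicate m = filter-all (0 <?_) (All-replicate⁺ m (s≤s z≤n))

maximumWitness : ∀ k r → ∃ λ T → IsSYT (2 * k + r) T × oddCols (shape T) ≡ r
                                 × shape T ≡ dropZeros (r ∷ replicate (2 * k) 1)
                                 × maj T ≡ (2 * k + r) C 2 ∸ r C 2
maximumWitness zero     zero     = [] , []-isSYT , refl , refl , refl
maximumWitness k        (suc r′) = hook r (2 * k) , isSYT , oddCols≡r , shape≡ , maj≡
  where
  r : ℕ
  r = suc r′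
  isSYT : IsSYT (2 * k + r) (hook r (2 * k))
  isSYT = subst (λ n → IsSYT n (hook r (2 * k))) (+-comm r (2 * k)) (hook-isSYT r (2 * k) (s≤s z≤n))
  1+2k%2≡1 : suc (2 * k) % 2 ≡ 1
  1+2k%2≡1 = trans (cong (λ x → suc x % 2) (*-comm 2 k)) ([m+kn]%n≡m%n 1 k 2)
  oddCols≡r : oddCols (shape (hook r (2 * k))) ≡ r
  oddCols≡r = begin
    oddCols (shape (hook r (2 * k)))      ≡⟨ cong oddCols (shape-hook r (2 * k)) ⟩
    oddCols (r ∷ replicate (2 * k) 1)     ≡⟨ oddCols-hook r′ (2 * k) ⟩
    r′ + suc (2 * k) % 2                  ≡⟨ cong (r′ +_) 1+2k%2≡1 ⟩
    r′ + 1                                ≡⟨ +-comm r′ 1 ⟩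
    r                                     ∎
    where open ≡-Reasoning
  shape≡ : shape (hook r (2 * k)) ≡ dropZeros (r ∷ replicate (2 * k) 1)
  shape≡ = trans (shape-hook r (2 * k)) (cong (r ∷_) (sym (dropZeros-replicate (2 * k))))
  maj≡ : maj (hook r (2 * k)) ≡ (2 * k + r) C 2 ∸ r C 2
  maj≡ = trans (maj-hook r (2 * k) (s≤s z≤n)) (cong (λ n → n C 2 ∸ r C 2) (+-comm r (2 * k)))
maximumWitness (suc k′) zero     = hook 1 m , isSYT , oddCols≡0 , shape≡ , maj≡
  where
  m : ℕ
  m = k′ + suc (k′ + 0)
  isSYT : IsSYT (2 * suc k′ + 0) (hook 1 m)
  isSYT = subst (λ n → IsSYT n (hook 1 m)) (sym (+-identityʳ (suc m))) (hook-isSYT 1 m (s≤s z≤n))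
  oddCols≡0 : oddCols (shape (hook 1 m)) ≡ 0
  oddCols≡0 = trans (cong oddCols (shape-hook 1 m))
                    (trans (oddCols-hook 0 m) (trans (cong (_% 2) (*-comm 2 (suc k′))) (m*n%n≡0 (suc k′) 2)))
  shape≡ : shape (hook 1 m) ≡ dropZeros (0 ∷ replicate (2 * suc k′) 1)
  shape≡ = trans (shape-hook 1 m) (sym (dropZeros-replicate (suc m)))
  maj≡ : maj (hook 1 m) ≡ (2 * suc k′ + 0) C 2 ∸ 0 C 2
  maj≡ = trans (maj-hook 1 m (s≤s z≤n)) (cong (λ n → n C 2 ∸ 0) (sym (+-identityʳ (suc m))))

-- For k = 0 the maximising tableau is also minimising.
minimumWitness : ∀ k r → ∃ λ T → IsSYT (2 * k + r) T × oddCols (shape T) ≡ r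
                                 × shape T ≡ dropZeros ((2 * k + r) ∸ k ∷ k ∷ []) × maj T ≡ k
minimumWitness zero r with maximumWitness 0 r
... | T , isSYT , oddCols≡r , shape≡ , maj≡ =
  T , isSYT , oddCols≡r , trans shape≡ dropZeros-r≡ , trans maj≡ (n∸n≡0 (r C 2))
  where
  dropZeros-r≡ : dropZeros (r ∷ []) ≡ dropZeros (r ∷ 0 ∷ [])
  dropZeros-r≡ = sym (trans (filter-++ (0 <?_) (r ∷ []) (0 ∷ [])) (++-identityʳ _))
minimumWitness (suc k′) r =
  twoRow k r , isSYT , trans (cong oddCols (shape-twoRow k r)) (oddCols-twoRow k r) , shape≡
  , maj-twoRow k r (s≤s z≤n)
  where
  k : ℕ
  k = suc k′
  k+k+r≡2k+r : k + k + r ≡ 2 * k + r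
  k+k+r≡2k+r = cong (λ x → k + x + r) (sym (+-identityʳ k))
  isSYT : IsSYT (2 * k + r) (twoRow k r)
  isSYT = subst (λ n → IsSYT n (twoRow k r)) k+k+r≡2k+r (twoRow-isSYT k r (s≤s z≤n))
  shape≡ : shape (twoRow k r) ≡ dropZeros ((2 * k + r) ∸ k ∷ k ∷ [])
  shape≡ = trans (shape-twoRow k r) (cong (λ p → dropZeros (p ∷ k ∷ [])) (sym (begin
    2 * k + r ∸ k     ≡⟨ cong (_∸ k) (trans (sym k+k+r≡2k+r) (+-assoc k k r)) ⟩
    k + (k + r) ∸ k   ≡⟨ m+n∸m≡n k (k + r) ⟩
    k + r             ∎)))
    where open ≡-Reasoning

mainTheorem2 : ∀ (k r : ℕ) →
    ((∀ (T : Tableau) → IsSYT (2 * k + r) T → oddCols (shape T) ≡ r → k ≤ maj T)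
      × ∃ λ (T : Tableau) → IsSYT (2 * k + r) T × oddCols (shape T) ≡ r
          × shape T ≡ dropZeros ((2 * k + r) ∸ k ∷ k ∷ []) × maj T ≡ k)
  × ((∀ (T : Tableau) → IsSYT (2 * k + r) T → oddCols (shape T) ≡ r
          → maj T ≤ (2 * k + r) C 2 ∸ r C 2)
      × ∃ λ (T : Tableau) → IsSYT (2 * k + r) T × oddCols (shape T) ≡ r
          × shape T ≡ dropZeros (r ∷ replicate (2 * k) 1)
          × maj T ≡ (2 * k + r) C 2 ∸ r C 2)
mainTheorem2 k r =
  ( (λ T syt oddCols≡r → k≤maj syt oddCols≡r)
  , minimumWitness k r )
  , ( (λ T syt → StandardTableau.maj≤n-C-2∸r-C-2 syt)
    , maximumWitness k r )
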